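{- Let $E^0$ be a finite set of ground equations over $\Sigma$. The application of the rules Abstract1 and Abstract2, starting from the configuration $\langle E^0\mid\emptyset\rangle$, terminates and produces a configuration of the form $\langle\emptyset\mid E^\infty_{\mathcal{A}}\rangle$ where $E^\infty_{\mathcal{A}}\subseteq\mathcal{A}$.
   Context: $\Sigma=\Sigma_{AC}\uplus\Sigma_{\mathcal{E}}\uplus\Sigma_{\mathsf{X}}$ is a signature: $\Sigma_{AC}$ binary associative-commutative symbols, $\Sigma_{\mathcal{E}}$ uninterpreted symbols (written $\Sigma_\emptyset$ in this part of the paper), and $\Sigma_{\mathsf{X}}$ the signature of a Shostak theory $\mathsf{X}$; $=_{AC,\mathsf{X}}$ denotes equality modulo the associativity–commutativity axioms of $\Sigma_{AC}$ and the axioms of $\mathsf{X}$. Let $K$ be a set of fresh constant symbols disjoint from $\Sigma$ and from the variables, and $\mathcal{T}(\Sigma_{\mathsf{X}}\cup K)$ the ground terms built from $\Sigma_{\mathsf{X}}$ and $K$. Define $\mathcal{T}_\emptyset=\{f(v_1,\dots,v_n)\mid f\in\Sigma_{\mathcal{E}},\ \mathrm{arity}(f)=n,\ v_1,\dots,v_n\in\mathcal{T}(\Sigma_{\mathsf{X}}\cup K)\}$ and $\mathcal{T}_{AC}=\{u(v_1,u(v_2,\dots,u(v_{n-1},v_n)\dots))\mid u\in\Sigma_{AC},\ n\geq2,\ v_1,\dots,v_n\in\mathcal{T}(\Sigma_{\mathsf{X}}\cup K)\}$. An equation $s\approx t$ (unordered) is abstracted if (1) $s,t\in\mathcal{T}(\Sigma_{\mathsf{X}}\cup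 K)$, or (2) $s\in\mathcal{T}_\emptyset\cup\mathcal{T}_{AC}$ and $t\in\mathcal{T}(\Sigma_{\mathsf{X}}\cup K)$, or (3) $s,t\in\mathcal{T}_{AC}$ and $s,t$ have the same root symbol. $\mathcal{A}$ is the set of abstracted equations. Let $\pi:\mathcal{T}_{AC}\cup\mathcal{T}_\emptyset\to K$ be a function such that $\pi(s)=\pi(t)$ implies $s=_{AC,\mathsf{X}}t$. The abstraction rules act on pairs $\langle E\mid E_{\mathcal{A}}\rangle$ of sets of equations: Abstract1: $\langle E\uplus\{s\approx t\}\mid E_{\mathcal{A}}\rangle\Rightarrow\langle E\mid E_{\mathcal{A}}\cup\{s\approx t\}\rangle$ if $s\approx t\in\mathcal{A}$. Abstract2: $\langle E\cup\{C[f(\vec v)]\approx t\}\mid E_{\mathcal{A}}\rangle\Rightarrow\langle E\cup\{C[k]\approx t\}\mid E_{\mathcal{A}}\cup\{f(\vec v)\approx k\}\rangle$ if $C[f(\vec v)]\approx t\notin\mathcal{A}$, $f(\vec v)\in\mathcal{T}_\emptyset\cup\mathcal{T}_{AC}$ is a subterm at some position of the left side (given by the context $C[\cdot]$), and $k=\pi(f(\vec v))$. -}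

module Defs where

open import Data.Nat using (ℕ)
open import Data.Vec using (Vec; []; _∷_)
open import Data.Vec.Relation.Unary.All using (All)
open import Data.List using (List; []; _∷_; _++_; [_])
open import Data.Product using (Σ; _×_; _,_; ∃)
open import Data.Sum using (_⊎_)
open import Relation.Nullary using (¬_)

-- The signature Σ = Σ_AC ⊎ Σ_E ⊎ Σ_X together with the fresh constants K.
-- AC symbols are binary; FE n / FX n are the uninterpreted / Shostak-theory
-- symbols of arity n (constants of Σ are the arity-0 symbols).
record Signature : Set₁ where
  field
    AC : Set
    FE : ℕ → Set
    FX : ℕ → Set
    K  : Set

module _ (S : Signature) where
  open Signature S

  data Term : Set where
    cst : K → Term
    ac  : AC → Term → Term → Term
    fe  : ∀ {n} → FE n → Vec Term n → Term
    fx  : ∀ {n} → FX n → Vec Term n → Term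

  -- an (unordered) equation s ≈ t
  Equation : Set
  Equation = Term × Term

  data NoK : Term → Set where
    noK-ac : ∀ {u s t} → NoK s → NoK t → NoK (ac u s t)
    noK-fe : ∀ {n} {f : FE n} {ts} → All NoK ts → NoK (fe f ts)
    noK-fx : ∀ {n} {f : FX n} {ts} → All NoK ts → NoK (fx f ts)

  data IsX : Term → Set where
    isX-cst : ∀ {k} → IsX (cst k)
    isX-fx  : ∀ {n} {g : FX n} {ts} → All IsX ts → IsX (fx g ts)

  data IsE : Term → Set where
    isE : ∀ {n} {f : FE n} {ts} → All IsX ts → IsE (fe f ts)

  data ACChain (u : AC) : Term → Set where
    two  : ∀ {a b} → IsX a → IsX b → ACChain u (ac u a b)
    cons : ∀ {a b} → IsX a → ACChain u b → ACChain u (ac u a b)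

  IsAC : Term → Set
  IsAC t = ∃ λ u → ACChain u t

  InDom : Term → Set
  InDom t = IsE t ⊎ IsAC t

  -- the set 𝒜 of abstracted equations (equations are unordered)
  Abstracted : Equation → Set
  Abstracted (s , t) =
    (IsX s × IsX t)
    ⊎ (InDom s × IsX t)
    ⊎ (InDom t × IsX s)
    ⊎ (∃ λ u → ACChain u s × ACChain u t)

  data Repl (p r : Term) : Term → Term → Set
  data ReplVec (p r : Term) : ∀ {n} → Vec Term n → Vec Term n → Set

  data Repl p r where
    here : Repl p r p r
    acˡ  : ∀ {u a a' b} → Repl p r a a' → Repl p r (ac u a b) (ac u a' b)
    acʳ  : ∀ {u a b b'} → Repl p r b b' → Repl p r (ac u a b) (ac u a b')
    feᵃ  : ∀ {n} {f : FE n} {ts ts'} → ReplVec p r ts ts' → Repl p r (fe f ts) (fe f ts')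
    fxᵃ  : ∀ {n} {g : FX n} {ts ts'} → ReplVec p r ts ts' → Repl p r (fx g ts) (fx g ts')

  data ReplVec p r where
    hd : ∀ {n} {a a'} {ts : Vec Term n} → Repl p r a a' → ReplVec p r (a ∷ ts) (a' ∷ ts)
    tl : ∀ {n} {a} {ts ts' : Vec Term n} → ReplVec p r ts ts' → ReplVec p r (a ∷ ts) (a ∷ ts')

  -- configurations ⟨E ∣ E_𝒜⟩ (finite sets represented by lists)
  Config : Set
  Config = List Equation × List Equation

  data Step (π : Term → K) : Config → Config → Set where
    abstract1 : ∀ {E₁ E₂ EA} e → Abstracted e →
      Step π (E₁ ++ e ∷ E₂ , EA) (E₁ ++ E₂ , EA ++ [ e ])
    abstract2ˡ : ∀ {E₁ E₂ EA} s t p s' → ¬ Abstracted (s , t) → InDom p →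
      Repl p (cst (π p)) s s' →
      Step π (E₁ ++ (s , t) ∷ E₂ , EA) (E₁ ++ (s' , t) ∷ E₂ , EA ++ [ (p , cst (π p)) ])
    abstract2ʳ : ∀ {E₁ E₂ EA} s t p t' → ¬ Abstracted (s , t) → InDom p →
      Repl p (cst (π p)) t t' →
      Step π (E₁ ++ (s , t) ∷ E₂ , EA) (E₁ ++ (s , t') ∷ E₂ , EA ++ [ (p , cst (π p)) ])

  -- reversed step relation: c' ◁ c iff c ⇒ c'  (used for termination via Acc)
  StepBack : (π : Term → K) → Config → Config → Set
  StepBack π c' c = Step π c c'

module Submission where

-- Termination: measure a configuration ⟨E ∣ E_𝒜⟩ by the total size of the
-- equations still in E, where every equation counts at least 1 and constants
-- of K have size 0.  Abstract1 removes an equation from E; Abstract2 replaces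
-- a subterm of T_∅ ∪ T_AC (size ≥ 1) by the constant π(p) (size 0), and
-- replacing a subterm by a smaller one shrinks the whole term.  So every step
-- strictly decreases this natural-number measure, and accessibility follows
-- from the well-foundedness of _<_ on ℕ.
--
-- Shape of the final configuration: every ground term either lies in
-- T(Σ_X ∪ K) or contains a subterm of T_∅ ∪ T_AC.  Hence an equation of E
-- that is not abstracted always enables Abstract2, and an abstracted one
-- enables Abstract1: a configuration with no successor has E = ∅.  Finally
-- each rule only adds abstracted equations to E_𝒜, an invariant along every
-- derivation from ⟨E⁰ ∣ ∅⟩.

open import Defs
open import Data.List using (List; []; _∷_; _++_)
open import Data.List.Relation.Unary.All using (All)
import Data.List.Relation.Unary.All as ListAll
open import Data.List.Relation.Unary.All.Properties using (++⁺)
open import Data.Product using (_×_; _,_; proj₁; proj₂)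
open import Data.Sum using (_⊎_; inj₁; inj₂)
open import Data.Empty using (⊥; ⊥-elim)
open import Data.Nat using (ℕ; suc; _+_; _<_; z<s; s<s)
open import Data.Nat.Properties using (+-monoˡ-<; +-monoʳ-<; m<n+m)
open import Data.Nat.Induction using (<-wellFounded)
open import Data.Vec using (Vec; []; _∷_)
import Data.Vec.Relation.Unary.All as VecAll
open import Relation.Nullary using (¬_)
open import Relation.Binary.PropositionalEquality using (_≡_; refl)
open import Relation.Binary.Construct.Closure.ReflexiveTransitive using (Star)
open import Induction.WellFounded using (Acc; module Subrelation)
import Relation.Binary.Construct.On as On

module _ (S : Signature) where

  size : Term S → ℕ
  sizeVec : ∀ {n} → Vec (Term S) n → ℕ
  size (cst _)    = 0
  size (ac _ a b) = suc (size a + size b)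
  size (fe _ ts)  = suc (sizeVec ts)
  size (fx _ ts)  = suc (sizeVec ts)
  sizeVec []       = 0
  sizeVec (t ∷ ts) = size t + sizeVec ts

  repl-shrinks : ∀ {p r s s'} → size r < size p → Repl S p r s s' → size s' < size s
  replVec-shrinks : ∀ {p r n} {ts ts' : Vec (Term S) n} →
    size r < size p → ReplVec S p r ts ts' → sizeVec ts' < sizeVec ts
  repl-shrinks r<p here = r<p
  repl-shrinks {s = ac _ _ b} r<p (acˡ rp) = s<s (+-monoˡ-< (size b) (repl-shrinks r<p rp))
  repl-shrinks {s = ac _ a _} r<p (acʳ rp) = s<s (+-monoʳ-< (size a) (repl-shrinks r<p rp))
  repl-shrinks r<p (feᵃ rv) = s<s (replVec-shrinks r<p rv)
  repl-shrinks r<p (fxᵃ rv) = s<s (replVec-shrinks r<p rv)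
  replVec-shrinks {ts = _ ∷ ts} r<p (hd rp) = +-monoˡ-< (sizeVec ts) (repl-shrinks r<p rp)
  replVec-shrinks {ts = a ∷ _}  r<p (tl rv) = +-monoʳ-< (size a) (replVec-shrinks r<p rv)

  inDom-nonconstant : ∀ {p} → InDom S p → 0 < size p
  inDom-nonconstant (inj₁ (isE _))        = z<s
  inDom-nonconstant (inj₂ (_ , two _ _))  = z<s
  inDom-nonconstant (inj₂ (_ , cons _ _)) = z<s

  eqWeight : Equation S → ℕ
  eqWeight (s , t) = suc (size s + size t)

  weight : List (Equation S) → ℕ
  weight []      = 0
  weight (e ∷ E) = eqWeight e + weight E

  weight-frame : ∀ E₁ {xs ys} → weight ys < weight xs → weight (E₁ ++ ys) < weight (E₁ ++ xs)
  weight-frame []       ys<xs = ys<xs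
  weight-frame (e ∷ E₁) ys<xs = +-monoʳ-< (eqWeight e) (weight-frame E₁ ys<xs)

  module _ (π : Term S → Signature.K S) where

    record Redex (t : Term S) : Set where
      constructor redex
      field
        {subterm} : Term S
        inDom     : InDom S subterm
        {result}  : Term S
        replaced  : Repl S subterm (cst (π subterm)) t result

    record RedexVec {n} (ts : Vec (Term S) n) : Set where
      constructor redexVec
      field
        {subterm} : Term S
        inDom     : InDom S subterm
        {result}  : Vec (Term S) n
        replaced  : ReplVec S subterm (cst (π subterm)) ts result

    -- The redex is
    -- found innermost-first: an AC- or Σ_∅-rooted term whose arguments are all
    -- in T(Σ_X ∪ K) is itself in T_AC or T_∅.
    isX-or-redex : (t : Term S) → IsX S t ⊎ Redex t
    isXVec-or-redex : ∀ {n} (ts : Vec (Term S) n) → VecAll.All (IsX S) ts ⊎ RedexVec ts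
    isX-or-redex (cst _) = inj₁ isX-cst
    isX-or-redex (ac u a b) with isX-or-redex a | isX-or-redex b
    ... | inj₂ (redex d rp) | _                  = inj₂ (redex d (acˡ rp))
    ... | inj₁ _            | inj₂ (redex d rp)  = inj₂ (redex d (acʳ rp))
    ... | inj₁ xa           | inj₁ xb            = inj₂ (redex (inj₂ (u , two xa xb)) here)
    isX-or-redex (fe f ts) with isXVec-or-redex ts
    ... | inj₁ xs                = inj₂ (redex (inj₁ (isE xs)) here)
    ... | inj₂ (redexVec d rv)   = inj₂ (redex d (feᵃ rv))
    isX-or-redex (fx g ts) with isXVec-or-redex ts
    ... | inj₁ xs                = inj₁ (isX-fx xs)
    ... | inj₂ (redexVec d rv)   = inj₂ (redex d (fxᵃ rv))
    isXVec-or-redex [] = inj₁ VecAll.[]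
    isXVec-or-redex (t ∷ ts) with isX-or-redex t | isXVec-or-redex ts
    ... | inj₂ (redex d rp) | _                     = inj₂ (redexVec d (hd rp))
    ... | inj₁ _            | inj₂ (redexVec d rv)  = inj₂ (redexVec d (tl rv))
    ... | inj₁ xt           | inj₁ xs               = inj₁ (xt VecAll.∷ xs)

    measure : Config S → ℕ
    measure (E , _) = weight E

    step-decreases : ∀ {c c'} → Step S π c c' → measure c' < measure c
    step-decreases (abstract1 {E₁} {E₂} _ _) =
      weight-frame E₁ (m<n+m (weight E₂) z<s)
    step-decreases (abstract2ˡ {E₁} {E₂} _ t _ _ _ d rp) =
      weight-frame E₁ (+-monoˡ-< (weight E₂) (s<s
        (+-monoˡ-< (size t) (repl-shrinks (inDom-nonconstant d) rp))))
    step-decreases (abstract2ʳ {E₁} {E₂} s _ _ _ _ d rp) =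
      weight-frame E₁ (+-monoˡ-< (weight E₂) (s<s
        (+-monoʳ-< (size s) (repl-shrinks (inDom-nonconstant d) rp))))

    terminates : ∀ c → Acc (StepBack S π) c
    terminates c = Subrelation.accessible step-decreases
      (On.accessible measure (<-wellFounded (measure c)))

    -- A configuration to which no rule applies has no unprocessed equation:
    -- the first equation of E would be removed by Abstract1 if abstracted, and
    -- otherwise one of its sides contains a redex for Abstract2.
    stuck⇒done : ∀ E EA → (∀ c' → ¬ Step S π (E , EA) c') → E ≡ []
    stuck⇒done []            _  _     = refl
    stuck⇒done ((s , t) ∷ E) EA stuck = ⊥-elim (enabled (isX-or-redex s) (isX-or-redex t))
      where
        not-abstracted : ¬ Abstracted S (s , t)
        not-abstracted a = stuck _ (abstract1 {E₁ = []} {E₂ = E} {EA} (s , t) a)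

        enabled : IsX S s ⊎ Redex s → IsX S t ⊎ Redex t → ⊥
        enabled (inj₂ (redex d rp)) _ =
          stuck _ (abstract2ˡ {E₁ = []} {E₂ = E} {EA} s t _ _ not-abstracted d rp)
        enabled (inj₁ _) (inj₂ (redex d rp)) =
          stuck _ (abstract2ʳ {E₁ = []} {E₂ = E} {EA} s t _ _ not-abstracted d rp)
        enabled (inj₁ xs) (inj₁ xt) = not-abstracted (inj₁ (xs , xt))

    AbstractedStore : Config S → Set
    AbstractedStore (_ , EA) = All (Abstracted S) EA

    step-preserves : ∀ {c c'} → Step S π c c' → AbstractedStore c → AbstractedStore c'
    step-preserves (abstract1 _ a)             inv = ++⁺ inv (a ListAll.∷ ListAll.[])
    step-preserves (abstract2ˡ _ _ _ _ _ d _) inv = ++⁺ inv (inj₂ (inj₁ (d , isX-cst)) ListAll.∷ ListAll.[])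
    step-preserves (abstract2ʳ _ _ _ _ _ d _) inv = ++⁺ inv (inj₂ (inj₁ (d , isX-cst)) ListAll.∷ ListAll.[])

    derivation-preserves : ∀ {c c'} → Star (Step S π) c c' → AbstractedStore c → AbstractedStore c'
    derivation-preserves Star.ε          inv = inv
    derivation-preserves (st Star.◅ sts) inv = derivation-preserves sts (step-preserves st inv)

proposition6p2 : (S : Signature)
    (_≈ACX_ : Term S → Term S → Set)
    (π : Term S → Signature.K S)
    → (∀ s t → InDom S s → InDom S t → π s ≡ π t → s ≈ACX t)
    → (E⁰ : List (Equation S))
    → All (λ e → NoK S (proj₁ e) × NoK S (proj₂ e)) E⁰
    → Acc (StepBack S π) (E⁰ , [])
    × (∀ c → Star (Step S π) (E⁰ , []) c → (∀ c' → ¬ Step S π c c')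
    → (proj₁ c ≡ []) × All (Abstracted S) (proj₂ c))
proposition6p2 S _ π _ E⁰ _ = terminates S π (E⁰ , []) , final
  where
    final : ∀ c → Star (Step S π) (E⁰ , []) c → (∀ c' → ¬ Step S π c c')
          → (proj₁ c ≡ []) × All (Abstracted S) (proj₂ c)
    final (E , EA) derivation stuck =
      stuck⇒done S π E EA stuck , derivation-preserves S π derivation ListAll.[]
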